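{- Let $n\ge1$. If $Q_{2n}$ has a source cycle, then $Q_{4n}$ has a source cycle.
   Context: $Q_{2m}$ is identified with $C_4\Box\cdots\Box C_4$ ($m$ factors): vertices are quaternary strings $(q_1,\dots,q_m)$, adjacent iff they differ in exactly one position by $\pm1\pmod4$; the positions are the axes $1,\dots,m$. An edge between vertices differing in position $i$, traversed from $q_i$ to $q_i+1$, is labelled $i$, and traversed the other way $\overline i$. Directed Hamilton cycles start and end at the origin and are recorded as label sequences $e_1\cdots e_N$. A Hamilton decomposition (H.D.) of $Q_{2m}$ is a set of $m$ directed Hamilton cycles whose edge sets partition the edges. A permutation $\sigma$ of $\{1,\dots,m\}$ acts by $(q_1,\dots,q_m)\mapsto(q_{\sigma^{ -1}(1)},\dots,q_{\sigma^{ -1}(m)})$, sending $e_1\cdots e_N$ to $\sigma(e_1)\cdots\sigma(e_N)$ with $\sigma(\overline i)=\overline{\sigma(i)}$. A Latin family is $\{\sigma_1,\dots,\sigma_m\}$ with $\sigma_1=\mathrm{id}$ and $(\sigma_i(j))_{i,j}$ a Latin square. A source cycle of $Q_{2m}$ is a directed Hamilton cycle $H$ such that, for some Latin family, $\{\sigma_1(H),\dots,\sigma_m(H)\}$ is an H.D. of $Q_{2m}$. -}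

module Defs where

open import Data.Nat using (ℕ; zero; suc; _^_)
open import Data.Fin using (Fin; zero; suc; toℕ)
open import Data.Vec using (Vec; replicate; updateAt)
open import Data.List using (List; []; _∷_; map; length)
open import Data.List.Relation.Unary.Unique.Propositional using (Unique)
open import Data.List.Membership.Propositional using (_∈_)
open import Data.Product using (Σ; _×_; _,_; ∃!)
open import Data.Fin.Permutation using (Permutation′; _⟨$⟩ʳ_)
open import Function.Definitions using (Injective)
open import Relation.Binary.PropositionalEquality using (_≡_)

inc4 : Fin 4 → Fin 4
inc4 zero = suc zero
inc4 (suc zero) = suc (suc zero)
inc4 (suc (suc zero)) = suc (suc (suc zero))
inc4 (suc (suc (suc zero))) = zero

dec4 : Fin 4 → Fin 4
dec4 zero = suc (suc (suc zero))
dec4 (suc zero) = zero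
dec4 (suc (suc zero)) = suc zero
dec4 (suc (suc (suc zero))) = suc (suc zero)

-- Vertices of Q_{2m} = C4 □ ... □ C4 (m factors): quaternary strings of length m
Vertex : ℕ → Set
Vertex m = Vec (Fin 4) m

origin : (m : ℕ) → Vertex m
origin m = replicate m zero

-- Edge labels: plus i = "i" (q_i ↦ q_i+1), minus i = "ī" (q_i ↦ q_i-1)
data Label (m : ℕ) : Set where
  plus  : Fin m → Label m
  minus : Fin m → Label m

step : {m : ℕ} → Vertex m → Label m → Vertex m
step v (plus i)  = updateAt v i inc4
step v (minus i) = updateAt v i dec4

-- Undirected edges, canonically: (v , i) is the edge {v , v + e_i}
Edge : ℕ → Set
Edge m = Vertex m × Fin m

edgeAt : {m : ℕ} → Vertex m → Label m → Edge m
edgeAt v (plus i)  = v , i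
edgeAt v (minus i) = updateAt v i dec4 , i

visited : {m : ℕ} → Vertex m → List (Label m) → List (Vertex m)
visited v [] = []
visited v (e ∷ es) = v ∷ visited (step v e) es

endpoint : {m : ℕ} → Vertex m → List (Label m) → Vertex m
endpoint v [] = v
endpoint v (e ∷ es) = endpoint (step v e) es

edgesOf : {m : ℕ} → Vertex m → List (Label m) → List (Edge m)
edgesOf v [] = []
edgesOf v (e ∷ es) = edgeAt v e ∷ edgesOf (step v e) es

-- Directed Hamilton cycle of Q_{2m} starting and ending at the origin,
-- recorded as its label sequence e_1 ... e_N
IsHamCycle : (m : ℕ) → List (Label m) → Set
IsHamCycle m es =
  (length es ≡ 4 ^ m) ×
  (endpoint (origin m) es ≡ origin m) ×
  Unique (visited (origin m) es)

IsHD : (m : ℕ) → (Fin m → List (Label m)) → Set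
IsHD m H =
  ((j : Fin m) → IsHamCycle m (H j)) ×
  ((e : Edge m) → ∃! _≡_ (λ j → e ∈ edgesOf (origin m) (H j)))

actLabel : {m : ℕ} → Permutation′ m → Label m → Label m
actLabel σ (plus i)  = plus (σ ⟨$⟩ʳ i)
actLabel σ (minus i) = minus (σ ⟨$⟩ʳ i)

act : {m : ℕ} → Permutation′ m → List (Label m) → List (Label m)
act σ = map (actLabel σ)

IsLatinSquare : (m : ℕ) → (Fin m → Fin m → Fin m) → Set
IsLatinSquare m L =
  ((i : Fin m) → Injective _≡_ _≡_ (L i)) ×
  ((j : Fin m) → Injective _≡_ _≡_ (λ i → L i j))

-- Latin family {σ_1, ..., σ_m} (indexed by Fin m, σ_1 is index 0)
IsLatinFamily : (m : ℕ) → (Fin m → Permutation′ m) → Set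
IsLatinFamily m σ =
  ((i : Fin m) → toℕ i ≡ 0 → (j : Fin m) → σ i ⟨$⟩ʳ j ≡ j) ×
  IsLatinSquare m (λ i j → σ i ⟨$⟩ʳ j)

IsSourceCycle : (m : ℕ) → List (Label m) → Set
IsSourceCycle m H =
  IsHamCycle m H ×
  Σ (Fin m → Permutation′ m) (λ σ → IsLatinFamily m σ × IsHD m (λ i → act (σ i) H))

HasSourceCycle : ℕ → Set
HasSourceCycle m = Σ (List (Label m)) (IsSourceCycle m)

-- Let H be a source cycle of Q_{2n} with Latin family σ, let N = 4 ^ n, and let v_k and e_k be the vertices and
-- edges of H (indices mod N). In Q_{4n} = Q_{2n} □ Q_{2n} walk N rounds, each consisting of one step of H in the
-- first copy followed by N−1 steps of H in the second copy. After t steps the walk is at (v_{X t}, v_{Y t}), where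
-- X t + Y t = t and X t = ⌈t/N⌉; the position determines X t and Y t mod N, hence t mod N and then ⌊t/N⌋, so the
-- walk is a Hamilton cycle H′ of Q_{4n}. Applying σ_c to both copies, either keeping or swapping them, gives a
-- Latin family of 2n permutations. An edge of Q_{4n} inside one copy is (σ_c e_k, σ_c v_z) for a unique c (the
-- σ_c H decompose Q_{2n}) and unique k, z mod N. It can only be the image of step t of H′ with t ≡ k + z (mod N),
-- and whether that step moves in the first or the second copy decides whether the edge lies in the kept or in the
-- swapped image of H′ under σ_c.

module Submission where

open import Defs
open import Data.Nat using (ℕ; zero; suc; _+_; _*_; _<_; _≤_; s≤s; z≤n; _^_; _%_; _/_; pred)
open import Data.Nat.Properties
  using (+-suc; +-comm; +-assoc; +-identityʳ; ≤-refl; ≤-trans; n≤1+n; n<1+n; <-irrefl; <⇒≢; <-trans;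
         ^-distribˡ-+-*; ^-monoʳ-≤; m^n≢0; suc-pred)
open import Data.Nat.DivMod
  using (m≡m%n+[m/n]*n; [m+n]%n≡m%n; [m+kn]%n≡m%n; %-distribˡ-+; m%n%n≡m%n; m*n%n≡0; n%n≡0; m%n<n;
         m<n⇒m%n≡m; m<n*o⇒m/o<n)
open import Data.Fin using (Fin; zero; suc; toℕ; _↑ˡ_; _↑ʳ_; splitAt; join; funToFin; finToFun)
open import Data.Fin.Properties
  using (_≟_; any?; toℕ<n; toℕ-injective; injective⇒≤; finToFun-funToFin; splitAt-↑ˡ; splitAt-↑ʳ; join-splitAt;
         toℕ-↑ˡ; toℕ-↑ʳ)
open import Data.Fin.Permutation using (Permutation′; permutation; flip; _⟨$⟩ʳ_; _⟨$⟩ˡ_; inverseˡ; inverseʳ)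
open import Data.Vec using (Vec; []; _∷_; _++_; lookup; tabulate; updateAt)
import Data.Vec as Vec
open import Data.Vec.Relation.Binary.Pointwise.Extensional using (ext; Pointwise-≡⇒≡)
open import Data.Vec.Properties
  using (lookup∘tabulate; lookup∘updateAt; lookup∘updateAt′; lookup-replicate;
         lookup-++ˡ; lookup-++ʳ; ++-injective; updateAt-updateAt; updateAt-cong; updateAt-id; ≡-dec)
open import Data.List using (List; []; _∷_; map; length; applyUpTo)
open import Data.List.Properties using (length-map; length-applyUpTo)
open import Data.List.Relation.Unary.Unique.Propositional using (Unique)
import Data.List.Relation.Unary.Unique.Propositional.Properties as Unique
open import Data.List.Relation.Unary.AllPairs using (_∷_)
import Data.List.Relation.Unary.All.Properties as All
open import Data.List.Membership.Propositional using (_∈_)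
open import Data.List.Membership.Propositional.Properties using (∈-map⁻; ∈-map⁺; ∈-applyUpTo⁻; ∈-applyUpTo⁺)
open import Data.Product using (_×_; _,_; proj₁; proj₂; ∃; uncurry)
open import Data.Sum using (inj₁; inj₂; [_,_]′)
open import Data.Empty using (⊥-elim)
open import Function using (_∘_; id)
open import Function.Definitions using (Injective)
open import Relation.Binary.Definitions using (DecidableEquality)
open import Relation.Binary.PropositionalEquality
open import Relation.Nullary using (yes; no; ¬_)

-- Permuting the axes

infix 4 _∈ₑ_
_∈ₑ_ : ∀ {m} → Edge m → List (Label m) → Set
_∈ₑ_ {m} e ls = e ∈ edgesOf (origin m) ls

module _ {m : ℕ} (π : Permutation′ m) where

  permuteVertex : Vertex m → Vertex m
  permuteVertex v = tabulate (λ j → lookup v (π ⟨$⟩ˡ j))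

  permuteEdge : Edge m → Edge m
  permuteEdge (v , i) = permuteVertex v , π ⟨$⟩ʳ i

  lookup-permuteVertex : ∀ v j → lookup (permuteVertex v) j ≡ lookup v (π ⟨$⟩ˡ j)
  lookup-permuteVertex v j = lookup∘tabulate _ j

  lookup-permuteVertex-⟨$⟩ʳ : ∀ v i → lookup (permuteVertex v) (π ⟨$⟩ʳ i) ≡ lookup v i
  lookup-permuteVertex-⟨$⟩ʳ v i = trans (lookup-permuteVertex v _) (cong (lookup v) (inverseˡ π))

  permuteVertex-updateAt : ∀ v i f → permuteVertex (updateAt v i f) ≡ updateAt (permuteVertex v) (π ⟨$⟩ʳ i) f
  permuteVertex-updateAt v i f = Pointwise-≡⇒≡ (ext pointwise)
    where
    open ≡-Reasoning
    pointwise : ∀ j → lookup (permuteVertex (updateAt v i f)) j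
                    ≡ lookup (updateAt (permuteVertex v) (π ⟨$⟩ʳ i) f) j
    pointwise j with j ≟ π ⟨$⟩ʳ i
    ... | yes refl = begin
      lookup (permuteVertex (updateAt v i f)) (π ⟨$⟩ʳ i)  ≡⟨ lookup-permuteVertex-⟨$⟩ʳ (updateAt v i f) i ⟩
      lookup (updateAt v i f) i                           ≡⟨ lookup∘updateAt i v ⟩
      f (lookup v i)                                      ≡⟨ cong f (lookup-permuteVertex-⟨$⟩ʳ v i) ⟨
      f (lookup (permuteVertex v) (π ⟨$⟩ʳ i))             ≡⟨ lookup∘updateAt (π ⟨$⟩ʳ i) (permuteVertex v) ⟨
      lookup (updateAt (permuteVertex v) (π ⟨$⟩ʳ i) f) (π ⟨$⟩ʳ i) ∎
    ... | no j≢πi = begin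
      lookup (permuteVertex (updateAt v i f)) j  ≡⟨ lookup-permuteVertex (updateAt v i f) j ⟩
      lookup (updateAt v i f) (π ⟨$⟩ˡ j)         ≡⟨ lookup∘updateAt′ (π ⟨$⟩ˡ j) i π⁻¹j≢i v ⟩
      lookup v (π ⟨$⟩ˡ j)                        ≡⟨ lookup-permuteVertex v j ⟨
      lookup (permuteVertex v) j                 ≡⟨ lookup∘updateAt′ j (π ⟨$⟩ʳ i) j≢πi (permuteVertex v) ⟨
      lookup (updateAt (permuteVertex v) (π ⟨$⟩ʳ i) f) j ∎
      where
      π⁻¹j≢i : π ⟨$⟩ˡ j ≢ i
      π⁻¹j≢i eq = j≢πi (trans (sym (inverseʳ π)) (cong (π ⟨$⟩ʳ_) eq))

  permuteVertex-injective : ∀ {u w} → permuteVertex u ≡ permuteVertex w → u ≡ w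
  permuteVertex-injective {u} {w} eq = Pointwise-≡⇒≡ (ext λ i →
    trans (sym (lookup-permuteVertex-⟨$⟩ʳ u i))
      (trans (cong (λ v → lookup v (π ⟨$⟩ʳ i)) eq) (lookup-permuteVertex-⟨$⟩ʳ w i)))

  permuteVertex-surjective : ∀ w → ∃ λ v → permuteVertex v ≡ w
  permuteVertex-surjective w = v , Pointwise-≡⇒≡ (ext λ j →
    trans (lookup-permuteVertex v j) (trans (lookup∘tabulate _ (π ⟨$⟩ˡ j)) (cong (lookup w) (inverseʳ π))))
    where
    v : Vertex m
    v = tabulate (λ i → lookup w (π ⟨$⟩ʳ i))

  permuteEdge-injective : ∀ {e e′} → permuteEdge e ≡ permuteEdge e′ → e ≡ e′
  permuteEdge-injective {v , i} {w , j} eq = cong₂ _,_ (permuteVertex-injective (cong proj₁ eq))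
    (trans (sym (inverseˡ π)) (trans (cong (π ⟨$⟩ˡ_) (cong proj₂ eq)) (inverseˡ π)))

  permuteVertex-origin : permuteVertex (origin m) ≡ origin m
  permuteVertex-origin = Pointwise-≡⇒≡ (ext λ j →
    trans (lookup-permuteVertex (origin m) j)
      (trans (lookup-replicate {n = m} (π ⟨$⟩ˡ j) zero) (sym (lookup-replicate j zero))))

  permuteVertex-step : ∀ v l → permuteVertex (step v l) ≡ step (permuteVertex v) (actLabel π l)
  permuteVertex-step v (plus i) = permuteVertex-updateAt v i inc4
  permuteVertex-step v (minus i) = permuteVertex-updateAt v i dec4

  permuteEdge-edgeAt : ∀ v l → permuteEdge (edgeAt v l) ≡ edgeAt (permuteVertex v) (actLabel π l)
  permuteEdge-edgeAt v (plus i) = refl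
  permuteEdge-edgeAt v (minus i) = cong (_, π ⟨$⟩ʳ i) (permuteVertex-updateAt v i dec4)

  visited-act : ∀ v ls → visited (permuteVertex v) (act π ls) ≡ map permuteVertex (visited v ls)
  visited-act v [] = refl
  visited-act v (l ∷ ls) = cong (permuteVertex v ∷_)
    (trans (cong (λ u → visited u (act π ls)) (sym (permuteVertex-step v l))) (visited-act (step v l) ls))

  endpoint-act : ∀ v ls → endpoint (permuteVertex v) (act π ls) ≡ permuteVertex (endpoint v ls)
  endpoint-act v [] = refl
  endpoint-act v (l ∷ ls) =
    trans (cong (λ u → endpoint u (act π ls)) (sym (permuteVertex-step v l))) (endpoint-act (step v l) ls)

  edgesOf-act : ∀ v ls → edgesOf (permuteVertex v) (act π ls) ≡ map permuteEdge (edgesOf v ls)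
  edgesOf-act v [] = refl
  edgesOf-act v (l ∷ ls) = cong₂ _∷_ (sym (permuteEdge-edgeAt v l))
    (trans (cong (λ u → edgesOf u (act π ls)) (sym (permuteVertex-step v l))) (edgesOf-act (step v l) ls))

  edgesOf-origin-act : ∀ ls → edgesOf (origin m) (act π ls) ≡ map permuteEdge (edgesOf (origin m) ls)
  edgesOf-origin-act ls = trans (cong (λ u → edgesOf u (act π ls)) (sym permuteVertex-origin)) (edgesOf-act _ ls)

  IsHamCycle-act : ∀ {H} → IsHamCycle m H → IsHamCycle m (act π H)
  IsHamCycle-act {H} (len , closed , unique) =
    trans (length-map _ H) len ,
    trans (cong (λ u → endpoint u (act π H)) (sym permuteVertex-origin))
      (trans (endpoint-act _ H) (trans (cong permuteVertex closed) permuteVertex-origin)) ,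
    subst Unique (sym (trans (cong (λ u → visited u (act π H)) (sym permuteVertex-origin)) (visited-act _ H)))
      (Unique.map⁺ permuteVertex-injective unique)

-- Walks given by their label sequences

applyUpTo-cong : ∀ {A : Set} (f g : ℕ → A) L → (∀ t → t < L → f t ≡ g t) → applyUpTo f L ≡ applyUpTo g L
applyUpTo-cong f g zero eq = refl
applyUpTo-cong f g (suc L) eq =
  cong₂ _∷_ (eq 0 (s≤s z≤n)) (applyUpTo-cong (f ∘ suc) (g ∘ suc) L (λ t t<L → eq (suc t) (s≤s t<L)))

Unique-applyUpTo⇒injective : ∀ {A : Set} (f : ℕ → A) L → Unique (applyUpTo f L) →
                              ∀ {i j} → i < L → j < L → f i ≡ f j → i ≡ j
Unique-applyUpTo⇒injective f (suc L) _ {zero} {zero} _ _ _ = refl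
Unique-applyUpTo⇒injective f (suc L) (fresh ∷ _) {zero} {suc j} _ (s≤s j<L) eq =
  ⊥-elim (All.applyUpTo⁻ (f ∘ suc) L fresh j<L eq)
Unique-applyUpTo⇒injective f (suc L) (fresh ∷ _) {suc i} {zero} (s≤s i<L) _ eq =
  ⊥-elim (All.applyUpTo⁻ (f ∘ suc) L fresh i<L (sym eq))
Unique-applyUpTo⇒injective f (suc L) (_ ∷ unique) {suc i} {suc j} (s≤s i<L) (s≤s j<L) eq =
  cong suc (Unique-applyUpTo⇒injective (f ∘ suc) L unique i<L j<L eq)

nth : ∀ {A : Set} → A → List A → ℕ → A
nth d [] k = d
nth d (x ∷ xs) zero = x
nth d (x ∷ xs) (suc k) = nth d xs k

applyUpTo-nth : ∀ {A : Set} (d : A) xs → applyUpTo (nth d xs) (length xs) ≡ xs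
applyUpTo-nth d [] = refl
applyUpTo-nth d (x ∷ xs) = cong (x ∷_) (applyUpTo-nth d xs)

encodeVertex : ∀ {m} → Vertex m → Fin (4 ^ m)
encodeVertex v = funToFin (lookup v)

encodeVertex-injective : ∀ {m} {u w : Vertex m} → encodeVertex u ≡ encodeVertex w → u ≡ w
encodeVertex-injective {u = u} {w} eq = Pointwise-≡⇒≡ (ext λ i →
  trans (sym (finToFun-funToFin (lookup u) i))
    (trans (cong (λ k → finToFun k i) eq) (finToFun-funToFin (lookup w) i)))

injectiveOn⇒surjective : ∀ {A : Set} {K} → DecidableEquality A →
                         (encode : A → Fin K) → Injective _≡_ _≡_ encode →
                         (f : ℕ → A) → (∀ {i j} → i < K → j < K → f i ≡ f j → i ≡ j) →
                         ∀ a → ∃ λ t → t < K × f t ≡ a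
injectiveOn⇒surjective {K = K} _≟ᴬ_ encode encode-injective f f-injective a
  with any? (λ (z : Fin K) → f (toℕ z) ≟ᴬ a)
... | yes (z , fz≡a) = toℕ z , toℕ<n z , fz≡a
... | no a∉image = ⊥-elim (<-irrefl refl (injective⇒≤ g-injective))
  where
  g : Fin (suc K) → Fin K
  g zero = encode a
  g (suc z) = encode (f (toℕ z))
  g-injective : ∀ {x y} → g x ≡ g y → x ≡ y
  g-injective {zero} {zero} _ = refl
  g-injective {zero} {suc y} eq = ⊥-elim (a∉image (y , sym (encode-injective eq)))
  g-injective {suc x} {zero} eq = ⊥-elim (a∉image (x , encode-injective eq))
  g-injective {suc x} {suc y} eq =
    cong suc (toℕ-injective (f-injective (toℕ<n x) (toℕ<n y) (encode-injective eq)))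

vertex-injectiveOn⇒surjective : ∀ {m} (f : ℕ → Vertex m) →
                                (∀ {i j} → i < 4 ^ m → j < 4 ^ m → f i ≡ f j → i ≡ j) →
                                ∀ v → ∃ λ t → t < 4 ^ m × f t ≡ v
vertex-injectiveOn⇒surjective = injectiveOn⇒surjective (≡-dec _≟_) encodeVertex encodeVertex-injective

Follows : ∀ {m} → (ℕ → Vertex m) → (ℕ → Label m) → Set
Follows V f = ∀ t → V (suc t) ≡ step (V t) (f t)

module _ {m : ℕ} where

  visited-applyUpTo : ∀ {V : ℕ → Vertex m} {f : ℕ → Label m} → Follows V f → ∀ L →
                      visited (V 0) (applyUpTo f L) ≡ applyUpTo V L
  visited-applyUpTo follows zero = refl
  visited-applyUpTo {V} {f} follows (suc L) = cong (V 0 ∷_) (begin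
    visited (step (V 0) (f 0)) (applyUpTo (f ∘ suc) L)  ≡⟨ cong (λ u → visited u _) (follows 0) ⟨
    visited (V 1) (applyUpTo (f ∘ suc) L)               ≡⟨ visited-applyUpTo (follows ∘ suc) L ⟩
    applyUpTo (V ∘ suc) L                               ∎)
    where open ≡-Reasoning

  endpoint-applyUpTo : ∀ {V : ℕ → Vertex m} {f : ℕ → Label m} → Follows V f → ∀ L →
                       endpoint (V 0) (applyUpTo f L) ≡ V L
  endpoint-applyUpTo follows zero = refl
  endpoint-applyUpTo {V} {f} follows (suc L) =
    trans (cong (λ u → endpoint u (applyUpTo (f ∘ suc) L)) (sym (follows 0)))
          (endpoint-applyUpTo (follows ∘ suc) L)

  edgesOf-applyUpTo : ∀ {V : ℕ → Vertex m} {f : ℕ → Label m} → Follows V f → ∀ L →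
                      edgesOf (V 0) (applyUpTo f L) ≡ applyUpTo (λ t → edgeAt (V t) (f t)) L
  edgesOf-applyUpTo follows zero = refl
  edgesOf-applyUpTo {V} {f} follows (suc L) = cong (edgeAt (V 0) (f 0) ∷_)
    (trans (cong (λ u → edgesOf u (applyUpTo (f ∘ suc) L)) (sym (follows 0)))
           (edgesOf-applyUpTo (follows ∘ suc) L))

  module Walk {V : ℕ → Vertex m} {f : ℕ → Label m} (follows : Follows V f) (starts : V 0 ≡ origin m) where

    IsHamCycle-applyUpTo : ∀ {L} → L ≡ 4 ^ m → V L ≡ origin m →
                           (∀ {i j} → i < j → j < L → V i ≢ V j) → IsHamCycle m (applyUpTo f L)
    IsHamCycle-applyUpTo {L} size closes injective =
      trans (length-applyUpTo f L) size ,
      subst (λ u → endpoint u (applyUpTo f L) ≡ origin m) starts (trans (endpoint-applyUpTo follows L) closes) ,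
      subst (λ u → Unique (visited u (applyUpTo f L))) starts
        (subst Unique (sym (visited-applyUpTo follows L)) (Unique.applyUpTo⁺₁ V L injective))

    edgesOf-act-applyUpTo : ∀ π L → edgesOf (origin m) (act π (applyUpTo f L))
                                    ≡ map (permuteEdge π) (applyUpTo (λ t → edgeAt (V t) (f t)) L)
    edgesOf-act-applyUpTo π L = trans (edgesOf-origin-act π (applyUpTo f L))
      (cong (map (permuteEdge π))
        (trans (cong (λ u → edgesOf u (applyUpTo f L)) (sym starts)) (edgesOf-applyUpTo follows L)))

    ∈-edgesOf-act⁻ : ∀ π L {e} → e ∈ₑ act π (applyUpTo f L) →
                     ∃ λ t → t < L × e ≡ permuteEdge π (edgeAt (V t) (f t))
    ∈-edgesOf-act⁻ π L {e} e∈ with ∈-map⁻ (permuteEdge π) (subst (e ∈_) (edgesOf-act-applyUpTo π L) e∈)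
    ... | _ , e′∈ , refl with ∈-applyUpTo⁻ _ e′∈
    ... | t , t<L , refl = t , t<L , refl

    ∈-edgesOf-act⁺ : ∀ π {L t} → t < L → permuteEdge π (edgeAt (V t) (f t)) ∈ₑ act π (applyUpTo f L)
    ∈-edgesOf-act⁺ π {L} {t} t<L =
      subst (permuteEdge π (edgeAt (V t) (f t)) ∈_) (sym (edgesOf-act-applyUpTo π L))
            (∈-map⁺ (permuteEdge π) (∈-applyUpTo⁺ _ t<L))

-- Congruence modulo N

module Modulo (N-1 : ℕ) where

  N : ℕ
  N = suc N-1

  infix 4 _≋_
  record _≋_ (a b : ℕ) : Set where
    constructor mod-≡
    field %-≡ : a % N ≡ b % N
  open _≋_ public

  ≋-refl : ∀ {a} → a ≋ a
  ≋-refl = mod-≡ refl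

  ≋-sym : ∀ {a b} → a ≋ b → b ≋ a
  ≋-sym (mod-≡ eq) = mod-≡ (sym eq)

  ≋-trans : ∀ {a b c} → a ≋ b → b ≋ c → a ≋ c
  ≋-trans (mod-≡ eq) (mod-≡ eq′) = mod-≡ (trans eq eq′)

  ≡⇒≋ : ∀ {a b} → a ≡ b → a ≋ b
  ≡⇒≋ refl = ≋-refl

  +-cong-≋ : ∀ {a a′ b b′} → a ≋ a′ → b ≋ b′ → a + b ≋ a′ + b′
  +-cong-≋ {a} {a′} {b} {b′} (mod-≡ eq) (mod-≡ eq′) = mod-≡ (begin
    (a + b) % N              ≡⟨ %-distribˡ-+ a b N ⟩
    (a % N + b % N) % N      ≡⟨ cong₂ (λ x y → (x + y) % N) eq eq′ ⟩
    (a′ % N + b′ % N) % N    ≡⟨ %-distribˡ-+ a′ b′ N ⟨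
    (a′ + b′) % N            ∎)
    where open ≡-Reasoning

  suc-cong-≋ : ∀ {a b} → a ≋ b → suc a ≋ suc b
  suc-cong-≋ = +-cong-≋ (≋-refl {1})

  suc-cancel-≋ : ∀ {a b} → suc a ≋ suc b → a ≋ b
  suc-cancel-≋ {a} {b} eq = mod-≡ (begin
    a % N              ≡⟨ [m+n]%n≡m%n a N ⟨
    (a + N) % N        ≡⟨ cong (_% N) (+-suc a N-1) ⟩
    (suc a + N-1) % N  ≡⟨ %-≡ (+-cong-≋ eq (≋-refl {N-1})) ⟩
    (suc b + N-1) % N  ≡⟨ cong (_% N) (+-suc b N-1) ⟨
    (b + N) % N        ≡⟨ [m+n]%n≡m%n b N ⟩
    b % N              ∎)
    where open ≡-Reasoning

  +-cancelʳ-≋ : ∀ c {a b} → a + c ≋ b + c → a ≋ b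
  +-cancelʳ-≋ zero {a} {b} eq = subst₂ _≋_ (+-identityʳ a) (+-identityʳ b) eq
  +-cancelʳ-≋ (suc c) {a} {b} eq = +-cancelʳ-≋ c (suc-cancel-≋ (subst₂ _≋_ (+-suc a c) (+-suc b c) eq))

  +-cancelˡ-≋ : ∀ c {a b} → c + a ≋ c + b → a ≋ b
  +-cancelˡ-≋ c {a} {b} eq = +-cancelʳ-≋ c (subst₂ _≋_ (+-comm c a) (+-comm c b) eq)

  %-≋ : ∀ a → a % N ≋ a
  %-≋ a = mod-≡ (m%n%n≡m%n a N)

  N≋0 : N ≋ 0
  N≋0 = mod-≡ (n%n≡0 N)

  *N-≋0 : ∀ q → q * N ≋ 0
  *N-≋0 q = mod-≡ (m*n%n≡0 q N)

  ≋⇒≡ : ∀ {a b} → a < N → b < N → a ≋ b → a ≡ b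
  ≋⇒≡ a<N b<N (mod-≡ eq) = trans (sym (m<n⇒m%n≡m a<N)) (trans eq (m<n⇒m%n≡m b<N))

-- A Hamilton cycle as an N-periodic walk

inc4∘dec4 : ∀ x → inc4 (dec4 x) ≡ x
inc4∘dec4 zero = refl
inc4∘dec4 (suc zero) = refl
inc4∘dec4 (suc (suc zero)) = refl
inc4∘dec4 (suc (suc (suc zero))) = refl

updateAt-inc4∘dec4 : ∀ {m} (v : Vertex m) i → updateAt (updateAt v i dec4) i inc4 ≡ v
updateAt-inc4∘dec4 v i = begin
  updateAt (updateAt v i dec4) i inc4  ≡⟨ updateAt-updateAt i v ⟩
  updateAt v i (inc4 ∘ dec4)           ≡⟨ updateAt-cong i inc4∘dec4 v ⟩
  updateAt v i id                      ≡⟨ updateAt-id i v ⟩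
  v                                    ∎
  where open ≡-Reasoning

module HamiltonCycle {m : ℕ} (N-1 : ℕ) (size : 4 ^ m ≡ suc N-1) (default : Label m)
                     {H : List (Label m)} (ham : IsHamCycle m H) where

  open Modulo N-1 public

  label : ℕ → Label m
  label k = nth default H (k % N)

  vertex : ℕ → Vertex m
  vertex zero = origin m
  vertex (suc k) = step (vertex k) (label k)

  edge : ℕ → Edge m
  edge k = edgeAt (vertex k) (label k)

  vertex-follows : Follows vertex label
  vertex-follows k = refl

  private module W = Walk {V = vertex} {f = label} vertex-follows refl

  applyUpTo-label : applyUpTo label N ≡ H
  applyUpTo-label = begin
    applyUpTo label N                     ≡⟨ applyUpTo-cong _ _ N (λ _ t<N → cong (nth default H) (m<n⇒m%n≡m t<N)) ⟩
    applyUpTo (nth default H) N           ≡⟨ cong (applyUpTo (nth default H)) (trans (proj₁ ham) size) ⟨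
    applyUpTo (nth default H) (length H)  ≡⟨ applyUpTo-nth default H ⟩
    H                                     ∎
    where open ≡-Reasoning

  vertex-N : vertex N ≡ origin m
  vertex-N = begin
    vertex N                                  ≡⟨ endpoint-applyUpTo {V = vertex} {f = label} vertex-follows N ⟨
    endpoint (origin m) (applyUpTo label N)   ≡⟨ cong (endpoint (origin m)) applyUpTo-label ⟩
    endpoint (origin m) H                     ≡⟨ proj₁ (proj₂ ham) ⟩
    origin m                                  ∎
    where open ≡-Reasoning

  label-periodic : ∀ k → label (k + N) ≡ label k
  label-periodic k = cong (nth default H) ([m+n]%n≡m%n k N)

  vertex-periodic : ∀ k → vertex (k + N) ≡ vertex k
  vertex-periodic zero = vertex-N
  vertex-periodic (suc k) = cong₂ step (vertex-periodic k) (label-periodic k)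

  vertex-+* : ∀ a q → vertex (a + q * N) ≡ vertex a
  vertex-+* a zero = cong vertex (+-identityʳ a)
  vertex-+* a (suc q) = begin
    vertex (a + (N + q * N))  ≡⟨ cong (λ b → vertex (a + b)) (+-comm N (q * N)) ⟩
    vertex (a + (q * N + N))  ≡⟨ cong vertex (+-assoc a (q * N) N) ⟨
    vertex (a + q * N + N)    ≡⟨ vertex-periodic (a + q * N) ⟩
    vertex (a + q * N)        ≡⟨ vertex-+* a q ⟩
    vertex a                  ∎
    where open ≡-Reasoning

  vertex-% : ∀ k → vertex k ≡ vertex (k % N)
  vertex-% k = trans (cong vertex (m≡m%n+[m/n]*n k N)) (vertex-+* (k % N) (k / N))

  vertex-cong : ∀ {a b} → a ≋ b → vertex a ≡ vertex b
  vertex-cong {a} {b} (mod-≡ eq) = trans (vertex-% a) (trans (cong vertex eq) (sym (vertex-% b)))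

  label-cong : ∀ {a b} → a ≋ b → label a ≡ label b
  label-cong (mod-≡ eq) = cong (nth default H) eq

  edge-cong : ∀ {a b} → a ≋ b → edge a ≡ edge b
  edge-cong a≋b = cong₂ edgeAt (vertex-cong a≋b) (label-cong a≋b)

  vertex-injectiveOn : ∀ {i j} → i < N → j < N → vertex i ≡ vertex j → i ≡ j
  vertex-injectiveOn = Unique-applyUpTo⇒injective vertex N
    (subst Unique (visited-applyUpTo {V = vertex} {f = label} vertex-follows N)
      (subst (λ ls → Unique (visited (origin m) ls)) (sym applyUpTo-label) (proj₂ (proj₂ ham))))

  vertex-injective : ∀ {a b} → vertex a ≡ vertex b → a ≋ b
  vertex-injective {a} {b} eq =
    mod-≡ (vertex-injectiveOn (m%n<n a N) (m%n<n b N) (trans (sym (vertex-% a)) (trans eq (vertex-% b))))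

  vertex-surjective : ∀ v → ∃ λ k → vertex k ≡ v
  vertex-surjective v =
    let (k , _ , vertex-k≡v) = vertex-injectiveOn⇒surjective vertex injectiveOn v in k , vertex-k≡v
    where
    injectiveOn : ∀ {i j} → i < 4 ^ m → j < 4 ^ m → vertex i ≡ vertex j → i ≡ j
    injectiveOn {i} {j} i< j< = vertex-injectiveOn (subst (i <_) size i<) (subst (j <_) size j<)

  ∈-edgesOf-act⁻ : ∀ π {e} → e ∈ₑ act π H → ∃ λ k → e ≡ permuteEdge π (edge k)
  ∈-edgesOf-act⁻ π {e} e∈ =
    let (k , _ , e≡) = W.∈-edgesOf-act⁻ π N (subst (λ ls → e ∈ₑ act π ls) (sym applyUpTo-label) e∈) in k , e≡

  ∈-edgesOf-act⁺ : ∀ π k → permuteEdge π (edge k) ∈ₑ act π H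
  ∈-edgesOf-act⁺ π k = subst₂ (λ e ls → e ∈ₑ act π ls)
    (cong (permuteEdge π) (edge-cong (%-≋ k))) applyUpTo-label (W.∈-edgesOf-act⁺ π (m%n<n k N))

  module _ (2<N : 2 < N) where

    2≢0 : ¬ (2 ≋ 0)
    2≢0 (mod-≡ eq) with trans (sym (m<n⇒m%n≡m 2<N)) eq
    ... | ()

    -- Traversing one edge in both directions would make the cycle return after two steps.
    edge-plus≢edge-minus : ∀ a b {i j} → label a ≡ plus i → label b ≡ minus j →
                           (vertex a , i) ≢ (updateAt (vertex b) j dec4 , j)
    edge-plus≢edge-minus a b {i} la lb eq with cong proj₂ eq
    ... | refl = 2≢0 (+-cancelʳ-≋ b (≋-trans (≋-sym (suc-cong-≋ a≋1+b)) 1+a≋b))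
      where
      vertex-a≡vertex-1+b : vertex a ≡ vertex (suc b)
      vertex-a≡vertex-1+b = trans (cong proj₁ eq) (sym (cong (step (vertex b)) lb))
      vertex-1+a≡vertex-b : vertex (suc a) ≡ vertex b
      vertex-1+a≡vertex-b = begin
        vertex (suc a)                                ≡⟨ cong (step (vertex a)) la ⟩
        updateAt (vertex a) i inc4                    ≡⟨ cong (λ v → updateAt v i inc4) (cong proj₁ eq) ⟩
        updateAt (updateAt (vertex b) i dec4) i inc4  ≡⟨ updateAt-inc4∘dec4 (vertex b) i ⟩
        vertex b                                      ∎
        where open ≡-Reasoning
      a≋1+b : a ≋ suc b
      a≋1+b = vertex-injective vertex-a≡vertex-1+b
      1+a≋b : suc a ≋ b
      1+a≋b = vertex-injective vertex-1+a≡vertex-b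

    edge-injective : ∀ {a b} → edge a ≡ edge b → a ≋ b
    edge-injective {a} {b} with label a in la | label b in lb
    ... | plus i | plus j = λ eq → vertex-injective (cong proj₁ eq)
    ... | minus i | minus j = λ eq → suc-cancel-≋ (vertex-injective
      (trans (cong (step (vertex a)) la) (trans (cong proj₁ eq) (sym (cong (step (vertex b)) lb)))))
    ... | plus i | minus j = λ eq → ⊥-elim (edge-plus≢edge-minus a b la lb eq)
    ... | minus i | plus j = λ eq → ⊥-elim (edge-plus≢edge-minus b a lb la (sym eq))

-- Two copies of Q_{2n}

data Side : Set where
  first second : Side

infixl 7 _⊙_
_⊙_ : Side → Side → Side
first ⊙ t = t
second ⊙ first = second
second ⊙ second = first

⊙-cancelʳ : ∀ {s t} u → s ⊙ u ≡ t ⊙ u → s ≡ t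
⊙-cancelʳ {first} {first} _ _ = refl
⊙-cancelʳ {second} {second} _ _ = refl
⊙-cancelʳ {first} {second} first ()
⊙-cancelʳ {first} {second} second ()
⊙-cancelʳ {second} {first} first ()
⊙-cancelʳ {second} {first} second ()

⊙-involutive : ∀ s t → s ⊙ (s ⊙ t) ≡ t
⊙-involutive first t = refl
⊙-involutive second first = refl
⊙-involutive second second = refl

⊙-cancel : ∀ s t → s ⊙ t ⊙ t ≡ s
⊙-cancel first first = refl
⊙-cancel first second = refl
⊙-cancel second first = refl
⊙-cancel second second = refl

⊙-exchange : ∀ s t u → t ⊙ (s ⊙ u) ≡ s ⊙ t ⊙ u
⊙-exchange first t u = refl
⊙-exchange second first u = refl
⊙-exchange second second first = refl
⊙-exchange second second second = refl

pick : ∀ {A : Set} → Side → A → A → A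
pick first a b = a
pick second a b = b

pick-map : ∀ {A B : Set} (f : A → B) s a b → f (pick s a b) ≡ pick s (f a) (f b)
pick-map f first a b = refl
pick-map f second a b = refl

updateAt-++ˡ : ∀ {A : Set} {k l} (u : Vec A k) (w : Vec A l) i f →
               updateAt (u ++ w) (i ↑ˡ l) f ≡ updateAt u i f ++ w
updateAt-++ˡ (x ∷ u) w zero f = refl
updateAt-++ˡ (x ∷ u) w (suc i) f = cong (x ∷_) (updateAt-++ˡ u w i f)

updateAt-++ʳ : ∀ {A : Set} {k l} (u : Vec A k) (w : Vec A l) i f →
               updateAt (u ++ w) (k ↑ʳ i) f ≡ u ++ updateAt w i f
updateAt-++ʳ [] w i f = refl
updateAt-++ʳ (x ∷ u) w i f = cong (x ∷_) (updateAt-++ʳ u w i f)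

origin-++ : ∀ k l → origin k ++ origin l ≡ origin (k + l)
origin-++ zero l = refl
origin-++ (suc k) l = cong (zero ∷_) (origin-++ k l)

-- Q_{4n} = Q_{2n} □ Q_{2n}: `index s i` is axis i of copy s, and `liftVertex s a w` puts a in copy s and w in
-- the other copy.
module _ {n : ℕ} where

  index : Side → Fin n → Fin (n + n)
  index first i = i ↑ˡ n
  index second i = n ↑ʳ i

  unindex : Fin (n + n) → Side × Fin n
  unindex j = [ (first ,_) , (second ,_) ]′ (splitAt n j)

  unindex-index : ∀ s i → unindex (index s i) ≡ (s , i)
  unindex-index first i rewrite splitAt-↑ˡ n i n = refl
  unindex-index second i rewrite splitAt-↑ʳ n n i = refl

  index-unindex : ∀ j → uncurry index (unindex j) ≡ j
  index-unindex j with splitAt n j in eq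
  ... | inj₁ i = trans (cong (join n n) (sym eq)) (join-splitAt n n j)
  ... | inj₂ i = trans (cong (join n n) (sym eq)) (join-splitAt n n j)

  index-injective : ∀ {s t i k} → index s i ≡ index t k → s ≡ t × i ≡ k
  index-injective {s} {t} {i} {k} eq
    with trans (sym (unindex-index s i)) (trans (cong unindex eq) (unindex-index t k))
  ... | refl = refl , refl

  data Indexed : Fin (n + n) → Set where
    indexed : ∀ s i → Indexed (index s i)

  indexed? : ∀ j → Indexed j
  indexed? j = subst Indexed (index-unindex j) (indexed (proj₁ (unindex j)) (proj₂ (unindex j)))

  liftVertex : Side → Vertex n → Vertex n → Vertex (n + n)
  liftVertex s a w = pick s a w ++ pick s w a

  liftLabel : Side → Label n → Label (n + n)
  liftLabel s (plus i) = plus (index s i)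
  liftLabel s (minus i) = minus (index s i)

  liftEdge : Side → Edge n → Vertex n → Edge (n + n)
  liftEdge s (a , i) w = liftVertex s a w , index s i

  lookup-liftVertex : ∀ s t a w i → lookup (liftVertex s a w) (index t i) ≡ lookup (pick (s ⊙ t) a w) i
  lookup-liftVertex first first a w i = lookup-++ˡ a w i
  lookup-liftVertex first second a w i = lookup-++ʳ a w i
  lookup-liftVertex second first a w i = lookup-++ˡ w a i
  lookup-liftVertex second second a w i = lookup-++ʳ w a i

  updateAt-liftVertex : ∀ s a w i f →
                        updateAt (liftVertex s a w) (index s i) f ≡ liftVertex s (updateAt a i f) w
  updateAt-liftVertex first a w i f = updateAt-++ˡ a w i f
  updateAt-liftVertex second a w i f = updateAt-++ʳ w a i f

  step-liftLabel : ∀ s a w l → step (liftVertex s a w) (liftLabel s l) ≡ liftVertex s (step a l) w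
  step-liftLabel s a w (plus i) = updateAt-liftVertex s a w i inc4
  step-liftLabel s a w (minus i) = updateAt-liftVertex s a w i dec4

  edgeAt-liftLabel : ∀ s a w l → edgeAt (liftVertex s a w) (liftLabel s l) ≡ liftEdge s (edgeAt a l) w
  edgeAt-liftLabel s a w (plus i) = refl
  edgeAt-liftLabel s a w (minus i) = cong (_, index s i) (updateAt-liftVertex s a w i dec4)

  liftVertex-injective : ∀ s {a a′ w w′} → liftVertex s a w ≡ liftVertex s a′ w′ → a ≡ a′ × w ≡ w′
  liftVertex-injective first eq = ++-injective _ _ eq
  liftVertex-injective second eq with ++-injective _ _ eq
  ... | w≡w′ , a≡a′ = a≡a′ , w≡w′

  liftEdge-injective : ∀ {s t e e′ w w′} → liftEdge s e w ≡ liftEdge t e′ w′ →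
                       s ≡ t × e ≡ e′ × w ≡ w′
  liftEdge-injective {s} {t} {a , i} {a′ , i′} eq with index-injective {s} {t} (cong proj₂ eq)
  ... | refl , refl with liftVertex-injective s (cong proj₁ eq)
  ... | refl , refl = refl , refl , refl

  liftEdge-surjective : ∀ (e : Edge (n + n)) → ∃ λ s → ∃ λ e′ → ∃ λ w → e ≡ liftEdge s e′ w
  liftEdge-surjective (v , j) with indexed? j | Vec.splitAt n v
  ... | indexed first i | a , w , refl = first , (a , i) , w , refl
  ... | indexed second i | w , a , refl = second , (a , i) , w , refl

  doubled : Side → Permutation′ n → Permutation′ (n + n)
  doubled s π = permutation (act′ (π ⟨$⟩ʳ_)) (act′ (π ⟨$⟩ˡ_)) (cancel π) (cancel (flip π))
    where
    act′ : (Fin n → Fin n) → Fin (n + n) → Fin (n + n)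
    act′ f j = uncurry (λ t i → index (s ⊙ t) (f i)) (unindex j)
    cancel : ∀ ρ j → act′ (ρ ⟨$⟩ʳ_) (act′ (ρ ⟨$⟩ˡ_) j) ≡ j
    cancel ρ j with indexed? j
    ... | indexed t i rewrite unindex-index t i | unindex-index (s ⊙ t) (ρ ⟨$⟩ˡ i)
                            | ⊙-involutive s t | inverseʳ ρ {i} = refl

  doubled-⟨$⟩ʳ : ∀ s π t i → doubled s π ⟨$⟩ʳ index t i ≡ index (s ⊙ t) (π ⟨$⟩ʳ i)
  doubled-⟨$⟩ʳ s π t i rewrite unindex-index t i = refl

  doubled-⟨$⟩ˡ : ∀ s π t i → doubled s π ⟨$⟩ˡ index t i ≡ index (s ⊙ t) (π ⟨$⟩ˡ i)
  doubled-⟨$⟩ˡ s π t i rewrite unindex-index t i = refl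

  permuteVertex-doubled : ∀ s π t a w →
    permuteVertex (doubled s π) (liftVertex t a w) ≡ liftVertex (s ⊙ t) (permuteVertex π a) (permuteVertex π w)
  permuteVertex-doubled s π t a w = Pointwise-≡⇒≡ (ext pointwise)
    where
    open ≡-Reasoning
    pointwise : ∀ j → lookup (permuteVertex (doubled s π) (liftVertex t a w)) j
                    ≡ lookup (liftVertex (s ⊙ t) (permuteVertex π a) (permuteVertex π w)) j
    pointwise j with indexed? j
    ... | indexed u i = begin
      lookup (permuteVertex (doubled s π) (liftVertex t a w)) (index u i)
        ≡⟨ lookup-permuteVertex (doubled s π) (liftVertex t a w) (index u i) ⟩
      lookup (liftVertex t a w) (doubled s π ⟨$⟩ˡ index u i)
        ≡⟨ cong (lookup (liftVertex t a w)) (doubled-⟨$⟩ˡ s π u i) ⟩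
      lookup (liftVertex t a w) (index (s ⊙ u) (π ⟨$⟩ˡ i))
        ≡⟨ lookup-liftVertex t (s ⊙ u) a w (π ⟨$⟩ˡ i) ⟩
      lookup (pick (t ⊙ (s ⊙ u)) a w) (π ⟨$⟩ˡ i)
        ≡⟨ cong (λ r → lookup (pick r a w) (π ⟨$⟩ˡ i)) (⊙-exchange s t u) ⟩
      lookup (pick (s ⊙ t ⊙ u) a w) (π ⟨$⟩ˡ i)
        ≡⟨ lookup-permuteVertex π (pick (s ⊙ t ⊙ u) a w) i ⟨
      lookup (permuteVertex π (pick (s ⊙ t ⊙ u) a w)) i
        ≡⟨ cong (λ v → lookup v i) (pick-map (permuteVertex π) (s ⊙ t ⊙ u) a w) ⟩
      lookup (pick (s ⊙ t ⊙ u) (permuteVertex π a) (permuteVertex π w)) i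
        ≡⟨ lookup-liftVertex (s ⊙ t) u (permuteVertex π a) (permuteVertex π w) i ⟨
      lookup (liftVertex (s ⊙ t) (permuteVertex π a) (permuteVertex π w)) (index u i) ∎

  permuteEdge-doubled : ∀ s π t e w →
    permuteEdge (doubled s π) (liftEdge t e w) ≡ liftEdge (s ⊙ t) (permuteEdge π e) (permuteVertex π w)
  permuteEdge-doubled s π t (a , i) w = cong₂ _,_ (permuteVertex-doubled s π t a w) (doubled-⟨$⟩ʳ s π t i)

  doubledFamily : (Fin n → Permutation′ n) → Fin (n + n) → Permutation′ (n + n)
  doubledFamily σ j = uncurry (λ s c → doubled s (σ c)) (unindex j)

  doubledFamily-index : ∀ σ s c → doubledFamily σ (index s c) ≡ doubled s (σ c)
  doubledFamily-index σ s c rewrite unindex-index s c = refl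

  IsLatinFamily-doubledFamily : ∀ {σ} → IsLatinFamily n σ → IsLatinFamily (n + n) (doubledFamily σ)
  IsLatinFamily-doubledFamily {σ} (σ₀-id , _ , columns) = τ₀-id , rows , τ-columns
    where
    τ = doubledFamily σ

    τ-⟨$⟩ʳ : ∀ s c t k → τ (index s c) ⟨$⟩ʳ index t k ≡ index (s ⊙ t) (σ c ⟨$⟩ʳ k)
    τ-⟨$⟩ʳ s c t k =
      trans (cong (_⟨$⟩ʳ index t k) (doubledFamily-index σ s c)) (doubled-⟨$⟩ʳ s (σ c) t k)

    τ₀-id : ∀ j → toℕ j ≡ 0 → ∀ j′ → τ j ⟨$⟩ʳ j′ ≡ j′
    τ₀-id j j≡0 j′ with indexed? j | indexed? j′
    ... | indexed first c | indexed t k =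
      trans (τ-⟨$⟩ʳ first c t k) (cong (index t) (σ₀-id c (trans (sym (toℕ-↑ˡ c n)) j≡0) k))
    τ₀-id j j≡0 j′ | indexed second c | _ with trans (sym (toℕ-↑ʳ n c)) j≡0
    τ₀-id j j≡0 j′ | indexed second zero | _ | ()
    τ₀-id j j≡0 j′ | indexed second (suc c) | _ | ()

    rows : ∀ j → Injective _≡_ _≡_ (τ j ⟨$⟩ʳ_)
    rows j eq = trans (sym (inverseˡ (τ j))) (trans (cong (τ j ⟨$⟩ˡ_) eq) (inverseˡ (τ j)))

    τ-columns : ∀ j′ → Injective _≡_ _≡_ (λ j → τ j ⟨$⟩ʳ j′)
    τ-columns j′ {j} {j″} eq with indexed? j | indexed? j″ | indexed? j′
    ... | indexed s c | indexed s′ c′ | indexed t k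
      with index-injective {s ⊙ t} {s′ ⊙ t} (trans (sym (τ-⟨$⟩ʳ s c t k)) (trans eq (τ-⟨$⟩ʳ s′ c′ t k)))
    ... | s⊙t≡s′⊙t , σck≡σc′k = cong₂ index (⊙-cancelʳ t s⊙t≡s′⊙t) (columns k {c} {c′} σck≡σc′k)

-- The product cycle

module ProductCycle {n : ℕ} (N-1 : ℕ) (size : 4 ^ n ≡ suc N-1) (default : Label n)
                    {H : List (Label n)} (ham : IsHamCycle n H) where

  open HamiltonCycle N-1 size default ham public

  sideOfResidue : ℕ → Side
  sideOfResidue zero = first
  sideOfResidue (suc _) = second

  -- Step t moves in the first copy exactly when N divides t; X t and Y t count the earlier steps in each copy.
  side : ℕ → Side
  side t = sideOfResidue (t % N)

  X Y : ℕ → ℕ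
  X zero = zero
  X (suc t) = pick (side t) (suc (X t)) (X t)
  Y zero = zero
  Y (suc t) = pick (side t) (Y t) (suc (Y t))

  moving resting : ℕ → ℕ
  moving t = pick (side t) (X t) (Y t)
  resting t = pick (side t) (Y t) (X t)

  productLabel : ℕ → Label (n + n)
  productLabel t = liftLabel (side t) (label (moving t))

  productVertex : ℕ → Vertex (n + n)
  productVertex t = vertex (X t) ++ vertex (Y t)

  productCycle : List (Label (n + n))
  productCycle = applyUpTo productLabel (N * N)

  productVertex-liftVertex : ∀ t →
                             productVertex t ≡ liftVertex (side t) (vertex (moving t)) (vertex (resting t))
  productVertex-liftVertex t with side t
  ... | first = refl
  ... | second = refl

  productVertex-follows : Follows productVertex productLabel
  productVertex-follows t with side t
  ... | first = sym (step-liftLabel first (vertex (X t)) (vertex (Y t)) (label (X t)))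
  ... | second = sym (step-liftLabel second (vertex (Y t)) (vertex (X t)) (label (Y t)))

  productEdge-liftEdge : ∀ t → edgeAt (productVertex t) (productLabel t)
                               ≡ liftEdge (side t) (edge (moving t)) (vertex (resting t))
  productEdge-liftEdge t =
    trans (cong (λ v → edgeAt v (productLabel t)) (productVertex-liftVertex t))
          (edgeAt-liftLabel (side t) (vertex (moving t)) (vertex (resting t)) (label (moving t)))

  X+Y : ∀ t → X t + Y t ≡ t
  X+Y zero = refl
  X+Y (suc t) with side t
  ... | first = cong suc (X+Y t)
  ... | second = trans (+-suc (X t) (Y t)) (cong suc (X+Y t))

  moving+resting : ∀ t → moving t + resting t ≡ t
  moving+resting t with side t | X+Y t
  ... | first | X+Y≡t = X+Y≡t
  ... | second | X+Y≡t = trans (+-comm (Y t) (X t)) X+Y≡t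

  side-cong : ∀ {t u} → t ≋ u → side t ≡ side u
  side-cong (mod-≡ eq) = cong sideOfResidue eq

  side-within : ∀ q r → r < N → side (q * N + r) ≡ sideOfResidue r
  side-within q r r<N = cong sideOfResidue (trans (cong (_% N) (+-comm (q * N) r))
                                                  (trans ([m+kn]%n≡m%n r q N) (m<n⇒m%n≡m r<N)))

  X-suc : ∀ t {s} → side t ≡ s → X (suc t) ≡ pick s (suc (X t)) (X t)
  X-suc t = cong (λ s → pick s (suc (X t)) (X t))

  X-blockStart : ∀ q → X (q * N) ≡ q
  X-withinBlock : ∀ q r → r < N → X (q * N + suc r) ≡ suc q

  X-blockStart zero = refl
  X-blockStart (suc q) = trans (cong X (+-comm N (q * N))) (X-withinBlock q N-1 ≤-refl)

  X-withinBlock q zero _ = begin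
    X (q * N + 1)        ≡⟨ cong X (+-suc (q * N) 0) ⟩
    X (suc (q * N + 0))  ≡⟨ X-suc (q * N + 0) (side-within q 0 (s≤s z≤n)) ⟩
    suc (X (q * N + 0))  ≡⟨ cong (suc ∘ X) (+-identityʳ (q * N)) ⟩
    suc (X (q * N))      ≡⟨ cong suc (X-blockStart q) ⟩
    suc q                ∎
    where open ≡-Reasoning
  X-withinBlock q (suc r) 1+r<N = begin
    X (q * N + suc (suc r))  ≡⟨ cong X (+-suc (q * N) (suc r)) ⟩
    X (suc (q * N + suc r))  ≡⟨ X-suc (q * N + suc r) (side-within q (suc r) 1+r<N) ⟩
    X (q * N + suc r)        ≡⟨ X-withinBlock q r (<-trans (n<1+n r) 1+r<N) ⟩
    suc q                    ∎
    where open ≡-Reasoning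

  decompose : ∀ t → t ≡ t / N * N + t % N
  decompose t = trans (m≡m%n+[m/n]*n t N) (+-comm (t % N) (t / N * N))

  X-quotient : ∀ t → X t ≡ t / N + pick (side t) 0 1
  X-quotient t with t % N | decompose t | m%n<n t N
  ... | zero | t≡ | _ = begin
    X t                  ≡⟨ cong X (trans t≡ (+-identityʳ (t / N * N))) ⟩
    X (t / N * N)        ≡⟨ X-blockStart (t / N) ⟩
    t / N                ≡⟨ +-identityʳ (t / N) ⟨
    t / N + 0            ∎
    where open ≡-Reasoning
  ... | suc r | t≡ | 1+r<N = begin
    X t                  ≡⟨ cong X t≡ ⟩
    X (t / N * N + suc r) ≡⟨ X-withinBlock (t / N) r (<-trans (n<1+n r) 1+r<N) ⟩
    suc (t / N)          ≡⟨ +-comm (t / N) 1 ⟨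
    t / N + 1            ∎
    where open ≡-Reasoning

  productVertex-injectiveOn : ∀ {t u} → t < N * N → u < N * N →
                              productVertex t ≡ productVertex u → t ≡ u
  productVertex-injectiveOn {t} {u} t<N*N u<N*N eq = begin
    t                  ≡⟨ decompose t ⟩
    t / N * N + t % N  ≡⟨ cong₂ (λ q r → q * N + r) t/N≡u/N (%-≡ t≋u) ⟩
    u / N * N + u % N  ≡⟨ decompose u ⟨
    u                  ∎
    where
    open ≡-Reasoning
    Xt≋Xu : X t ≋ X u
    Xt≋Xu = vertex-injective (proj₁ (++-injective (vertex (X t)) (vertex (X u)) eq))
    Yt≋Yu : Y t ≋ Y u
    Yt≋Yu = vertex-injective (proj₂ (++-injective (vertex (X t)) (vertex (X u)) eq))
    t≋u : t ≋ u
    t≋u = subst₂ _≋_ (X+Y t) (X+Y u) (+-cong-≋ Xt≋Xu Yt≋Yu)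
    t/N≋u/N : t / N ≋ u / N
    t/N≋u/N = +-cancelʳ-≋ (pick (side t) 0 1) (subst₂ _≋_ (X-quotient t)
      (trans (X-quotient u) (cong (λ s → u / N + pick s 0 1) (side-cong (≋-sym t≋u)))) Xt≋Xu)
    t/N≡u/N : t / N ≡ u / N
    t/N≡u/N = ≋⇒≡ (m<n*o⇒m/o<n t<N*N) (m<n*o⇒m/o<n u<N*N) t/N≋u/N

  productVertex-start : productVertex 0 ≡ origin (n + n)
  productVertex-start = origin-++ n n

  productVertex-closes : productVertex (N * N) ≡ origin (n + n)
  productVertex-closes = begin
    vertex (X (N * N)) ++ vertex (Y (N * N))  ≡⟨ cong₂ _++_ (cong vertex (X-blockStart N)) (vertex-cong Y≋0) ⟩
    vertex N ++ vertex 0                      ≡⟨ cong (_++ origin n) vertex-N ⟩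
    origin n ++ origin n                      ≡⟨ origin-++ n n ⟩
    origin (n + n)                            ∎
    where
    open ≡-Reasoning
    N+Y≡N*N : N + Y (N * N) ≡ N * N
    N+Y≡N*N = trans (cong (_+ Y (N * N)) (sym (X-blockStart N))) (X+Y (N * N))
    Y≋0 : Y (N * N) ≋ 0
    Y≋0 = +-cancelˡ-≋ N (≋-trans (≡⇒≋ N+Y≡N*N) (≋-trans (*N-≋0 N)
            (≋-sym (subst (_≋ 0) (sym (+-identityʳ N)) N≋0))))

  productCycle-length : N * N ≡ 4 ^ (n + n)
  productCycle-length = trans (cong₂ _*_ (sym size) (sym size)) (sym (^-distribˡ-+-* 4 n n))

  private module Product = Walk {V = productVertex} {f = productLabel} productVertex-follows productVertex-start

  IsHamCycle-productCycle : IsHamCycle (n + n) productCycle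
  IsHamCycle-productCycle = Product.IsHamCycle-applyUpTo productCycle-length productVertex-closes
    (λ i<j j<N*N → <⇒≢ i<j ∘ productVertex-injectiveOn (<-trans i<j j<N*N) j<N*N)

  X-Y-surjective : ∀ a b → ∃ λ t → t < N * N × X t ≋ a × Y t ≋ b
  X-Y-surjective a b =
    let (t , t< , eq) = vertex-injectiveOn⇒surjective productVertex injectiveOn (vertex a ++ vertex b)
        (Xt≡a , Yt≡b) = ++-injective (vertex (X t)) (vertex a) eq
    in t , subst (t <_) (sym productCycle-length) t< , vertex-injective Xt≡a , vertex-injective Yt≡b
    where
    injectiveOn : ∀ {i j} → i < 4 ^ (n + n) → j < 4 ^ (n + n) →
                  productVertex i ≡ productVertex j → i ≡ j
    injectiveOn {i} {j} i< j< = productVertex-injectiveOn (subst (i <_) (sym productCycle-length) i<)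
                                                          (subst (j <_) (sym productCycle-length) j<)

  side-of : ∀ t {a b} → X t ≋ a → Y t ≋ b → side t ≡ sideOfResidue ((a + b) % N)
  side-of t {a} {b} Xt≋a Yt≋b = side-cong (subst (_≋ a + b) (X+Y t) (+-cong-≋ Xt≋a Yt≋b))

  moving≡ : ∀ t {s} → side t ≡ s → moving t ≡ pick s (X t) (Y t)
  moving≡ t = cong (λ s → pick s (X t) (Y t))

  resting≡ : ∀ t {s} → side t ≡ s → resting t ≡ pick s (Y t) (X t)
  resting≡ t = cong (λ s → pick s (Y t) (X t))

  moving-resting-surjective : ∀ k z → ∃ λ t → t < N * N × moving t ≋ k × resting t ≋ z
  moving-resting-surjective k z = by-side (sideOfResidue ((k + z) % N)) refl
    where
    by-side : ∀ s → sideOfResidue ((k + z) % N) ≡ s →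
              ∃ λ t → t < N * N × moving t ≋ k × resting t ≋ z
    by-side first side-k+z =
      let (t , t< , Xt≋k , Yt≋z) = X-Y-surjective k z
          side-t = trans (side-of t Xt≋k Yt≋z) side-k+z
      in t , t< , subst (_≋ k) (sym (moving≡ t side-t)) Xt≋k , subst (_≋ z) (sym (resting≡ t side-t)) Yt≋z
    by-side second side-k+z =
      let (t , t< , Xt≋z , Yt≋k) = X-Y-surjective z k
          side-t = trans (side-of t Xt≋z Yt≋k)
                         (trans (cong (λ a → sideOfResidue (a % N)) (+-comm z k)) side-k+z)
      in t , t< , subst (_≋ k) (sym (moving≡ t side-t)) Yt≋k , subst (_≋ z) (sym (resting≡ t side-t)) Xt≋z

  doubledEdge : Side → Permutation′ n → ℕ → Edge (n + n)
  doubledEdge s π t = liftEdge (s ⊙ side t) (permuteEdge π (edge (moving t))) (permuteVertex π (vertex (resting t)))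

  permuteEdge-productEdge : ∀ s π t →
                            permuteEdge (doubled s π) (edgeAt (productVertex t) (productLabel t)) ≡ doubledEdge s π t
  permuteEdge-productEdge s π t =
    trans (cong (permuteEdge (doubled s π)) (productEdge-liftEdge t))
          (permuteEdge-doubled s π (side t) (edge (moving t)) (vertex (resting t)))

  ∈-productCycle⁻ : ∀ s π {e} → e ∈ₑ act (doubled s π) productCycle → ∃ λ t → e ≡ doubledEdge s π t
  ∈-productCycle⁻ s π e∈ =
    let (t , _ , e≡) = Product.∈-edgesOf-act⁻ (doubled s π) (N * N) e∈
    in t , trans e≡ (permuteEdge-productEdge s π t)

  ∈-productCycle⁺ : ∀ s π {t} → t < N * N → doubledEdge s π t ∈ₑ act (doubled s π) productCycle
  ∈-productCycle⁺ s π {t} t< =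
    subst (_∈ₑ act (doubled s π) productCycle) (permuteEdge-productEdge s π t) (Product.∈-edgesOf-act⁺ (doubled s π) t<)

  module Decomposition (2<N : 2 < N) (σ : Fin n → Permutation′ n) (hd : IsHD n (λ c → act (σ c) H)) where

    τ : Fin (n + n) → Permutation′ (n + n)
    τ = doubledFamily σ

    Covers : Fin (n + n) → Edge (n + n) → Set
    Covers j e = e ∈ₑ act (τ j) productCycle

    Covers-index : ∀ s c {e} → Covers (index s c) e ≡ (e ∈ₑ act (doubled s (σ c)) productCycle)
    Covers-index s c {e} = cong (λ π → e ∈ₑ act π productCycle) (doubledFamily-index σ s c)

    colour-unique : ∀ {c c′ e} → e ∈ₑ act (σ c) H → e ∈ₑ act (σ c′) H → c ≡ c′
    colour-unique {e = e} e∈ e∈′ with proj₂ hd e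
    ... | _ , _ , unique = trans (sym (unique e∈)) (unique e∈′)

    side-unique : ∀ {c c′ s s′ t t′} → c ≡ c′ → s ⊙ side t ≡ s′ ⊙ side t′ →
                  permuteEdge (σ c) (edge (moving t)) ≡ permuteEdge (σ c′) (edge (moving t′)) →
                  permuteVertex (σ c) (vertex (resting t)) ≡ permuteVertex (σ c′) (vertex (resting t′)) →
                  s ≡ s′
    side-unique {c} {s′ = s′} {t} {t′} refl sides≡ edges≡ vertices≡ =
      ⊙-cancelʳ (side t) (trans sides≡ (cong (s′ ⊙_) (sym (side-cong t≋t′))))
      where
      t≋t′ : t ≋ t′
      t≋t′ = subst₂ _≋_ (moving+resting t) (moving+resting t′)
        (+-cong-≋ (edge-injective 2<N {moving t} {moving t′} (permuteEdge-injective (σ c) edges≡))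
                  (vertex-injective {resting t} {resting t′} (permuteVertex-injective (σ c) vertices≡)))

    index-unique : ∀ s c s′ c′ {e} → e ∈ₑ act (doubled s (σ c)) productCycle →
                   e ∈ₑ act (doubled s′ (σ c′)) productCycle → index s c ≡ index s′ c′
    index-unique s c s′ c′ e∈ e∈′ =
      let (t , e≡) = ∈-productCycle⁻ s (σ c) e∈
          (t′ , e≡′) = ∈-productCycle⁻ s′ (σ c′) e∈′
          (sides≡ , edges≡ , vertices≡) =
            liftEdge-injective {s = s ⊙ side t} {s′ ⊙ side t′} (trans (sym e≡) e≡′)
          c≡c′ = colour-unique (∈-edgesOf-act⁺ (σ c) (moving t))
                   (subst (_∈ₑ act (σ c′) H) (sym edges≡) (∈-edgesOf-act⁺ (σ c′) (moving t′)))
      in cong₂ index (side-unique {t = t} {t′} c≡c′ sides≡ edges≡ vertices≡) c≡c′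

    Covers-unique : ∀ {e j j′} → Covers j e → Covers j′ e → j ≡ j′
    Covers-unique {j = j} {j′} cov cov′ with indexed? {n} j | indexed? {n} j′
    ... | indexed s c | indexed s′ c′ =
      index-unique s c s′ c′ (subst id (Covers-index s c) cov) (subst id (Covers-index s′ c′) cov′)

    Covers-image : ∀ β c {t} → t < N * N →
                   Covers (index (β ⊙ side t) c)
                          (liftEdge β (permuteEdge (σ c) (edge (moving t))) (permuteVertex (σ c) (vertex (resting t))))
    Covers-image β c {t} t< = subst id (sym (Covers-index (β ⊙ side t) c))
      (subst (λ s → liftEdge s _ _ ∈ₑ act (doubled (β ⊙ side t) (σ c)) productCycle)
             (⊙-cancel β (side t)) (∈-productCycle⁺ (β ⊙ side t) (σ c) t<))

    Covers-liftEdge : ∀ β ej w → ∃ λ j → Covers j (liftEdge β ej w)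
    Covers-liftEdge β ej w =
      let (c , ej∈ , _) = proj₂ hd ej
          (k , ej≡) = ∈-edgesOf-act⁻ (σ c) ej∈
          (x , σx≡w) = permuteVertex-surjective (σ c) w
          (z , vz≡x) = vertex-surjective x
          (t , t< , moving≋k , resting≋z) = moving-resting-surjective k z
          edge≡ = trans (cong (permuteEdge (σ c)) (edge-cong moving≋k)) (sym ej≡)
          vertex≡ = trans (cong (permuteVertex (σ c)) (trans (vertex-cong resting≋z) vz≡x)) σx≡w
      in index (β ⊙ side t) c ,
         subst₂ (λ ej w → Covers (index (β ⊙ side t) c) (liftEdge β ej w)) edge≡ vertex≡ (Covers-image β c t<)

    Covers-exists : ∀ e → ∃ λ j → Covers j e
    Covers-exists e =
      let (β , ej , w , e≡) = liftEdge-surjective e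
          (j , cov) = Covers-liftEdge β ej w
      in j , subst (Covers j) (sym e≡) cov

    IsHD-productCycle : IsHD (n + n) (λ j → act (τ j) productCycle)
    IsHD-productCycle = (λ j → IsHamCycle-act (τ j) {productCycle} IsHamCycle-productCycle) ,
                        λ e → let (j , cov) = Covers-exists e in j , cov , Covers-unique {e} {j} cov

corollary3 : (n : ℕ) → 1 ≤ n → HasSourceCycle n → HasSourceCycle (2 * n)
corollary3 n@(suc _) _ (H , ham , σ , latin , hd) =
  subst HasSourceCycle 2*n≡n+n
    (productCycle , IsHamCycle-productCycle , τ , IsLatinFamily-doubledFamily {n} {σ} latin , IsHD-productCycle)
  where
  size : 4 ^ n ≡ suc (pred (4 ^ n))
  size = sym (suc-pred (4 ^ n) {{m^n≢0 4 n}})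
  open ProductCycle (pred (4 ^ n)) size (plus zero) ham
  2<N : 2 < N
  2<N = subst (2 <_) size (≤-trans (n≤1+n 3) (^-monoʳ-≤ 4 {1} {n} (s≤s z≤n)))
  open Decomposition 2<N σ hd
  2*n≡n+n : n + n ≡ 2 * n
  2*n≡n+n = cong (n +_) (sym (+-identityʳ n))
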